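{- For every integer $n > 1$, the number $\tau(n,0,0)$ of $\tau$-sequences $a_1 a_2 \dots a_n$ of length $n$ with $a_1 = 0$ and $a_n = 0$ equals $n - 1$.
   Context: A $\tau$-sequence of length $n$ is a sequence of integers $a_1 a_2 \dots a_n$ such that, with indices taken cyclically modulo $n$ (so $a_0 = a_n$): (i) $a_i \geq 0$ for all $i$; (ii) if $a_i > 0$ then $a_{i-1} = a_i - 1$; (iii) there are at most three indices $i$ with $a_i = 0$. (Equivalently, every cyclic rotation of the sequence satisfies (i)–(iii) with ordinary indices; informally, a $\tau$-sequence is a cyclic rotation of a concatenation of one, two or three runs $0,1,2,\dots$.) -}

module Defs where

open import Data.Nat using (ℕ; zero; suc; _≤_)
open import Data.Nat.Properties using (_≟_)
open import Data.Fin using (Fin; zero; suc; fromℕ; inject₁)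
open import Data.Vec using (Vec; lookup; count; head; last)
open import Data.Product using (_×_)
open import Relation.Binary.PropositionalEquality using (_≡_)

-- cyclic predecessor index on Fin (suc m): 0 ↦ m, i+1 ↦ i
-- (indices are 0-based here: position i of the Vec is a_{i+1} of the paper)
prev : ∀ {m} → Fin (suc m) → Fin (suc m)
prev {m} zero = fromℕ m
prev (suc i) = inject₁ i

zeros : ∀ {n} → Vec ℕ n → ℕ
zeros = count (_≟ 0)

-- τ-sequence of length suc m (cyclic indices).
-- (i) a_i ≥ 0 is automatic for ℕ.
-- (ii) if a_i > 0, i.e. a_i = suc k, then a_{i-1} = k = a_i - 1.
-- (iii) at most three indices with a_i = 0.
record IsTau {m : ℕ} (a : Vec ℕ (suc m)) : Set where
  field
    step      : ∀ (i : Fin (suc m)) (k : ℕ) → lookup a i ≡ suc k → lookup a (prev i) ≡ k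
    fewZeros  : zeros a ≤ 3

IsTau00 : ∀ {m : ℕ} → Vec ℕ (suc m) → Set
IsTau00 a = IsTau a × (head a ≡ 0 × last a ≡ 0)

module Submission where

-- A τ-sequence with a_1 = a_n = 0 is 0 ∷ b where the tail b (of length
-- n - 1) climbs from the leading 0 — every entry is 0 or one more than its
-- predecessor — ends in 0, and has at most two zeros.  Since b ends in 0
-- and may contain only one further zero, b is either 1 2 … (n-2) 0 or is
-- determined by the position of its single inner zero: n - 1 tails in all.
--
-- To count them we enumerate, for every starting value c, zero budget z and
-- length, the list  tails c z n  of all such tails by splitting on the first
-- entry (0, spending one zero, or c + 1).

open import Defs
open import Data.Nat using (ℕ; zero; suc; _+_; _<_; _≤_; _∸_; z≤n; s≤s)
open import Data.Nat.Properties using (≤-trans)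
open import Data.Fin using (Fin; zero; suc; inject₁)
open import Data.Vec using (Vec; []; _∷_; lookup; last)
open import Data.Vec.Properties using (∷-injectiveʳ)
open import Data.List using (List; []; _∷_; _++_; map; length)
open import Data.List.Properties using (length-++; length-map)
open import Data.List.Relation.Unary.Any using (here)
open import Data.List.Relation.Unary.All using ([])
open import Data.List.Relation.Unary.AllPairs using ([]; _∷_)
open import Data.List.Relation.Unary.Unique.Propositional using (Unique)
import Data.List.Relation.Unary.Unique.Propositional.Properties as Unique
open import Data.List.Membership.Propositional using (_∈_)
open import Data.List.Membership.Propositional.Properties
  using (∈-map⁺; ∈-map⁻; ∈-++⁺ˡ; ∈-++⁺ʳ; ∈-++⁻)
open import Data.Product using (_×_; _,_; ∃)
open import Data.Sum using (_⊎_; inj₁; inj₂)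
open import Data.Unit using (⊤; tt)
open import Relation.Nullary using (¬_)
open import Function.Bundles using (_⇔_; mk⇔; module Equivalence)
open import Relation.Binary.PropositionalEquality
  using (_≡_; refl; cong₂; trans)
open Relation.Binary.PropositionalEquality.≡-Reasoning

-- Climbs c b: read after an entry c, each entry of b is 0 or one more than
-- the entry before it (condition (ii) along a vector, without wrap-around).
Climbs : ∀ {n} → ℕ → Vec ℕ n → Set
Climbs c []      = ⊤
Climbs c (x ∷ b) = (x ≡ 0 ⊎ x ≡ suc c) × Climbs x b

Tail : ∀ {n} → ℕ → ℕ → Vec ℕ (suc n) → Set
Tail c z b = Climbs c b × last b ≡ 0 × zeros b ≤ z

tails : ℕ → ℕ → (n : ℕ) → List (Vec ℕ (suc n))
tails c zero    n       = []
tails c (suc z) zero    = (0 ∷ []) ∷ []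
tails c (suc z) (suc n) =
  map (0 ∷_) (tails 0 z n) ++ map (suc c ∷_) (tails (suc c) (suc z) n)

-- A vector ending in 0 contains a zero; hence the budget 0 admits no tail.
last≡0⇒zero : ∀ {n} (b : Vec ℕ (suc n)) → last b ≡ 0 → 1 ≤ zeros b
last≡0⇒zero (zero  ∷ [])    refl = s≤s z≤n
last≡0⇒zero (zero  ∷ _ ∷ _) _    = s≤s z≤n
last≡0⇒zero (suc _ ∷ y ∷ b) e    = last≡0⇒zero (y ∷ b) e

∈-map-∷ : ∀ {n} {x y : ℕ} {b : Vec ℕ n} {bs : List (Vec ℕ n)} →
  (x ∷ b) ∈ map (y ∷_) bs → x ≡ y × b ∈ bs
∈-map-∷ {y = y} p with ∈-map⁻ (y ∷_) p
... | _ , b∈bs , refl = refl , b∈bs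

tails-complete : ∀ {n} c z (b : Vec ℕ (suc n)) → Tail c z b → b ∈ tails c z n
tails-complete c zero b (_ , e , le) with ≤-trans (last≡0⇒zero b e) le
... | ()
tails-complete c (suc z) (zero ∷ []) _ = here refl
tails-complete c (suc z) (zero ∷ y ∷ b) ((_ , climbs) , e , s≤s le) =
  ∈-++⁺ˡ (∈-map⁺ (0 ∷_) (tails-complete 0 z (y ∷ b) (climbs , e , le)))
tails-complete c (suc z) (suc x ∷ y ∷ b) ((inj₂ refl , climbs) , e , le) =
  ∈-++⁺ʳ (map (0 ∷_) (tails 0 z _))
    (∈-map⁺ (suc c ∷_) (tails-complete (suc c) (suc z) (y ∷ b) (climbs , e , le)))

tails-sound : ∀ {n} c z (b : Vec ℕ (suc n)) → b ∈ tails c z n → Tail c z b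
tails-sound c (suc z) (x ∷ []) (here refl) = (inj₁ refl , tt) , refl , s≤s z≤n
tails-sound {suc n} c (suc z) (x ∷ y ∷ b) p
  with ∈-++⁻ (map (0 ∷_) (tails 0 z n)) p
... | inj₁ q with ∈-map-∷ q
...   | refl , r with tails-sound 0 z (y ∷ b) r
...     | climbs , e , le = (inj₁ refl , climbs) , e , s≤s le
tails-sound {suc n} c (suc z) (x ∷ y ∷ b) p | inj₂ q with ∈-map-∷ q
... | refl , r with tails-sound (suc c) (suc z) (y ∷ b) r
...   | climbs , e , le = (inj₂ refl , climbs) , e , le

-- No tail is listed twice: the two halves differ in their first entry.
tails-unique : ∀ c z n → Unique (tails c z n)
tails-unique c zero    n       = []
tails-unique c (suc z) zero    = [] ∷ []
tails-unique c (suc z) (suc n) =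
  Unique.++⁺ (Unique.map⁺ ∷-injectiveʳ (tails-unique 0 z n))
             (Unique.map⁺ ∷-injectiveʳ (tails-unique (suc c) (suc z) n))
             disjoint
  where
    disjoint : ∀ {v} → ¬ (v ∈ map (0 ∷_) (tails 0 z n) ×
                          v ∈ map (suc c ∷_) (tails (suc c) (suc z) n))
    disjoint (p , q) with ∈-map⁻ (0 ∷_) p | ∈-map⁻ (suc c ∷_) q
    ... | _ , _ , refl | _ , _ , ()

tails-length-step : ∀ c z n → length (tails c (suc z) (suc n)) ≡
  length (tails 0 z n) + length (tails (suc c) (suc z) n)
tails-length-step c z n = begin
  length (map (0 ∷_) xs ++ map (suc c ∷_) ys)       ≡⟨ length-++ (map (0 ∷_) xs) ⟩
  length (map (0 ∷_) xs) + length (map (suc c ∷_) ys)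
    ≡⟨ cong₂ _+_ (length-map (0 ∷_) xs) (length-map (suc c ∷_) ys) ⟩
  length xs + length ys                              ∎
  where
    xs = tails 0 z n
    ys = tails (suc c) (suc z) n

-- With one zero allowed, the only tail is c+1, c+2, …, 0.
tails-length₁ : ∀ c n → length (tails c 1 n) ≡ 1
tails-length₁ c zero    = refl
tails-length₁ c (suc n) = trans (tails-length-step c 0 n) (tails-length₁ (suc c) n)

-- With two zeros allowed, a tail of length n + 1 is fixed by the position
-- of its optional inner zero.
tails-length₂ : ∀ c n → length (tails c 2 n) ≡ suc n
tails-length₂ c zero    = refl
tails-length₂ c (suc n) = begin
  length (tails c 2 (suc n))                             ≡⟨ tails-length-step c 1 n ⟩
  length (tails 0 1 n) + length (tails (suc c) 2 n)
    ≡⟨ cong₂ _+_ (tails-length₁ 0 n) (tails-length₂ (suc c) n) ⟩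
  1 + suc n                                              ∎

-- Condition (ii) at the non-wrapping positions 1, …, n-1 of a vector x ∷ b.
SuccessorSteps : ∀ {n} → Vec ℕ (suc n) → Set
SuccessorSteps {n} a =
  ∀ (i : Fin n) k → lookup a (suc i) ≡ suc k → lookup a (inject₁ i) ≡ k

climbs⇒steps : ∀ {n} x (b : Vec ℕ n) → Climbs x b → SuccessorSteps (x ∷ b)
climbs⇒steps x (y ∷ b) (inj₁ refl , _) zero    k ()
climbs⇒steps x (y ∷ b) (inj₂ refl , _) zero    k refl = refl
climbs⇒steps x (y ∷ b) (_ , climbs)    (suc i) k e    = climbs⇒steps y b climbs i k e

steps⇒climbs : ∀ {n} x (b : Vec ℕ n) → SuccessorSteps (x ∷ b) → Climbs x b
steps⇒climbs x []          steps = tt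
steps⇒climbs x (zero ∷ b)  steps = inj₁ refl , steps⇒climbs 0 b (λ i → steps (suc i))
steps⇒climbs x (suc y ∷ b) steps with steps zero y refl
... | refl = inj₂ refl , steps⇒climbs (suc y) b (λ i → steps (suc i))

-- A vector starting with 0 is a τ-sequence ending in 0 exactly when its tail
-- is admissible with budget 2 (the leading 0 uses one of the three zeros,
-- and makes condition (ii) at the wrap-around position vacuous).
tau00⇔tail : ∀ {n} (b : Vec ℕ (suc n)) → IsTau00 (0 ∷ b) ⇔ Tail 0 2 b
tau00⇔tail {n} b = mk⇔ to from
  where
    to : IsTau00 (0 ∷ b) → Tail 0 2 b
    to (tau , _ , e) with IsTau.fewZeros tau
    ... | s≤s le = steps⇒climbs 0 b (λ i → IsTau.step tau (suc i)) , e , le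

    from : Tail 0 2 b → IsTau00 (0 ∷ b)
    from (climbs , e , le) = record { step = step ; fewZeros = s≤s le } , refl , e
      where
        step : ∀ (i : Fin (suc (suc n))) k →
          lookup (0 ∷ b) i ≡ suc k → lookup (0 ∷ b) (prev i) ≡ k
        step zero    k ()
        step (suc i) k = climbs⇒steps 0 b climbs i k

mainTheorem17 : ∀ (m : ℕ) → 1 < suc m →
    ∃ λ (L : List (Vec ℕ (suc m))) →
      Unique L × (∀ (a : Vec ℕ (suc m)) → (a ∈ L ⇔ IsTau00 a)) × length L ≡ suc m ∸ 1
mainTheorem17 zero    (s≤s ())
mainTheorem17 (suc m) _ =
  map (0 ∷_) (tails 0 2 m) ,
  Unique.map⁺ ∷-injectiveʳ (tails-unique 0 2 m) ,
  (λ a → mk⇔ (listed⇒tau a) (tau⇒listed a)) ,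
  trans (length-map (0 ∷_) (tails 0 2 m)) (tails-length₂ 0 m)
  where
    listed⇒tau : ∀ a → a ∈ map (0 ∷_) (tails 0 2 m) → IsTau00 a
    listed⇒tau (x ∷ b) p with ∈-map-∷ p
    ... | refl , b∈tails = Equivalence.from (tau00⇔tail b) (tails-sound 0 2 b b∈tails)

    tau⇒listed : ∀ a → IsTau00 a → a ∈ map (0 ∷_) (tails 0 2 m)
    tau⇒listed (x ∷ b) tau@(_ , refl , _) =
      ∈-map⁺ (0 ∷_) (tails-complete 0 2 b (Equivalence.to (tau00⇔tail b) tau))
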